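{- Let $B^+(m,n)$ be the signed bistar obtained from a positive edge $uv$ by attaching $m$ pendant vertices to $u$ via positive edges and $n$ pendant vertices to $v$ via negative edges. Then $B^+(m,n)$ is a parity signed graph if and only if either $m+n$ is odd and $n\in\{m+1,m+3\}$, or $m+n$ is even and $n=m+2$.
   Context: A signed graph is a pair $S=(G,\sigma)$ with $G$ a graph and $\sigma:E(G)\to\{+,-\}$. For a graph $G$ with $N$ vertices and a bijection $f:V(G)\to\{1,\dots,N\}$, define $\sigma_f(uv)=+$ if $f(u),f(v)$ have the same parity and $\sigma_f(uv)=-$ otherwise. $S$ is a parity signed graph if $\sigma=\sigma_f$ for some such bijection $f$. -}

module Defs where

open import Data.Nat using (ℕ; suc; _+_; _%_)
open import Data.Fin using (Fin; toℕ)
open import Function.Bundles using (_↔_; Inverse)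
open import Data.Product using (∃)
open import Relation.Binary.PropositionalEquality using (_≡_)
open import Relation.Nullary using (yes; no)
open import Data.Nat.Properties using (_≟_)

data Sign : Set where
  plus minus : Sign

-- A signed graph on a vertex type V with N vertices (N is the number of
-- vertices, witnessed by the bijection required in IsParitySigned).
-- Edges are given by an (oriented, for bookkeeping only) edge relation E;
-- σ assigns a sign to each edge.
record SignedGraph : Set₁ where
  field
    V : Set
    N : ℕ
    E : V → V → Set
    σ : ∀ {x y} → E x y → Sign

-- σ_f(xy) for labels in {1,…,N}: label of x is suc (toℕ (f x)).
σ-of : ∀ {N} → Fin N → Fin N → Sign
σ-of i j with (suc (toℕ i) % 2) ≟ (suc (toℕ j) % 2)
... | yes _ = plus
... | no _ = minus

IsParitySigned : SignedGraph → Set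
IsParitySigned S = ∃ λ (f : V ↔ Fin N) →
  ∀ {x y} (e : E x y) → σ e ≡ σ-of (Inverse.to f x) (Inverse.to f y)
  where open SignedGraph S

data BVtx (m n : ℕ) : Set where
  u v : BVtx m n
  a : Fin m → BVtx m n
  b : Fin n → BVtx m n

data BEdge {m n : ℕ} : BVtx m n → BVtx m n → Set where
  uv : BEdge u v
  ua : (i : Fin m) → BEdge u (a i)
  vb : (j : Fin n) → BEdge v (b j)

BSign : ∀ {m n} {x y : BVtx m n} → BEdge x y → Sign
BSign uv = plus
BSign (ua i) = plus
BSign (vb j) = minus

Bistar⁺ : ℕ → ℕ → SignedGraph
Bistar⁺ m n = record { V = BVtx m n ; N = m + n + 2 ; E = BEdge ; σ = BSign }

-- Among the labels 1,…,N there are ⌈N/2⌉ odd and ⌊N/2⌋ even ones, and σ_f is positive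
-- exactly between labels of equal parity. In B⁺(m,n) the edges force u, v and the pendants
-- of u into one parity class and the pendants of v into the other, so m + 2 and n are both
-- at most ⌈(m+n+2)/2⌉, i.e. m + 1 ≤ n ≤ m + 3. Conversely, for these three values the two
-- classes have sizes ⌈N/2⌉ and ⌊N/2⌋ in some order, and interleaving them gives the
-- labelling. The parity of m + n merely records which of the three values n takes.
module Submission where

open import Defs
open import Data.Nat using (ℕ; zero; suc; _+_; _*_; _%_; _/_; _≤_; _<_; z≤n; s≤s; ⌊_/2⌋; ⌈_/2⌉)
open import Data.Nat.Properties using (_≟_; +-comm; ≤-refl; ≤-trans; *-monoˡ-≤; +-cancelˡ-≤; n≡⌊n+n/2⌋; n≡⌈n+n/2⌉)
open import Data.Nat.DivMod using (m≡m%n+[m/n]*n; m<n*o⇒m/o<n; [m+n]%n≡m%n; [m+kn]%n≡m%n; %-distribˡ-+; m*n%n≡0; m%n<n)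
open import Data.Nat.Tactic.RingSolver using (solve-∀)
open import Data.Fin using (Fin; zero; suc; toℕ; fromℕ<)
open import Data.Fin.Properties using (toℕ-injective; toℕ-fromℕ<; toℕ<n; injective⇒≤)
open import Data.Product using (Σ; _×_; _,_)
open import Data.Sum using (_⊎_; inj₁; inj₂; swap; map; map₁)
open import Data.Sum.Properties using (inj₁-injective; inj₂-injective)
open import Data.Sum.Algebra using (⊎-comm)
open import Function using (_∘_; id)
open import Function.Bundles using (_⇔_; _↔_; Inverse; Injection; mk⇔; mk↔ₛ′)
open import Function.Definitions using (Injective)
open import Function.Properties.Inverse using (↔-sym; ↔-trans; ↔⇒↣)
open import Relation.Binary.PropositionalEquality using (_≡_; _≢_; refl; sym; trans; cong; cong₂; subst₂; module ≡-Reasoning)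
open import Relation.Nullary using (yes; no; contradiction)

open ≡-Reasoning

%2-suc : ∀ x → suc x % 2 ≡ suc (x % 2) % 2
%2-suc x = %-distribˡ-+ 1 x 2

%2-suc-suc : ∀ x → suc (suc x) % 2 ≡ x % 2
%2-suc-suc x = trans (cong (_% 2) (+-comm 2 x)) ([m+n]%n≡m%n x 2)

%2-suc-cong : ∀ {x y} → x % 2 ≡ y % 2 → suc x % 2 ≡ suc y % 2
%2-suc-cong {x} {y} e = begin
  suc x % 2         ≡⟨ %2-suc x ⟩
  suc (x % 2) % 2   ≡⟨ cong (λ r → suc r % 2) e ⟩
  suc (y % 2) % 2   ≡⟨ %2-suc y ⟨
  suc y % 2         ∎

%2-suc-injective : ∀ {x y} → suc x % 2 ≡ suc y % 2 → x % 2 ≡ y % 2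
%2-suc-injective {x} {y} e = begin
  x % 2               ≡⟨ %2-suc-suc x ⟨
  suc (suc x) % 2     ≡⟨ %2-suc-cong {suc x} {suc y} e ⟩
  suc (suc y) % 2     ≡⟨ %2-suc-suc y ⟩
  y % 2               ∎

%2≡0⊎%2≡1 : ∀ x → x % 2 ≡ 0 ⊎ x % 2 ≡ 1
%2≡0⊎%2≡1 x with x % 2 | m%n<n x 2
... | 0           | _ = inj₁ refl
... | 1           | _ = inj₂ refl
... | suc (suc _) | s≤s (s≤s ())

%2-≢⇒≡ : ∀ x y z → x % 2 ≢ z % 2 → y % 2 ≢ z % 2 → x % 2 ≡ y % 2
%2-≢⇒≡ x y z x≢z y≢z with %2≡0⊎%2≡1 x | %2≡0⊎%2≡1 y | %2≡0⊎%2≡1 z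
... | inj₁ p | inj₁ q | _      = trans p (sym q)
... | inj₂ p | inj₂ q | _      = trans p (sym q)
... | inj₁ p | inj₂ _ | inj₁ r = contradiction (trans p (sym r)) x≢z
... | inj₂ p | inj₁ _ | inj₂ r = contradiction (trans p (sym r)) x≢z
... | inj₁ _ | inj₂ q | inj₂ r = contradiction (trans q (sym r)) y≢z
... | inj₂ _ | inj₁ q | inj₁ r = contradiction (trans q (sym r)) y≢z

%2-/2-injective : ∀ {x y} → x % 2 ≡ y % 2 → x / 2 ≡ y / 2 → x ≡ y
%2-/2-injective {x} {y} p q = begin
  x                   ≡⟨ m≡m%n+[m/n]*n x 2 ⟩
  x % 2 + x / 2 * 2   ≡⟨ cong₂ (λ r h → r + h * 2) p q ⟩
  y % 2 + y / 2 * 2   ≡⟨ m≡m%n+[m/n]*n y 2 ⟨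
  y                   ∎

n≤⌈n/2⌉*2 : ∀ n → n ≤ ⌈ n /2⌉ * 2
n≤⌈n/2⌉*2 zero          = z≤n
n≤⌈n/2⌉*2 (suc zero)    = s≤s z≤n
n≤⌈n/2⌉*2 (suc (suc n)) = s≤s (s≤s (n≤⌈n/2⌉*2 n))

⌈n/2⌉*2≤1+n : ∀ n → ⌈ n /2⌉ * 2 ≤ suc n
⌈n/2⌉*2≤1+n zero          = z≤n
⌈n/2⌉*2≤1+n (suc zero)    = ≤-refl
⌈n/2⌉*2≤1+n (suc (suc n)) = s≤s (s≤s (⌈n/2⌉*2≤1+n n))

-- Parities are taken of the index toℕ i, one less than the label suc (toℕ i) used by σ-of.
σ-of-plus : ∀ {n} {i j : Fin n} → toℕ i % 2 ≡ toℕ j % 2 → σ-of i j ≡ plus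
σ-of-plus {i = i} {j} e with suc (toℕ i) % 2 ≟ suc (toℕ j) % 2
... | yes _  = refl
... | no ne = contradiction (%2-suc-cong {toℕ i} {toℕ j} e) ne

σ-of-minus : ∀ {n} {i j : Fin n} → toℕ i % 2 ≢ toℕ j % 2 → σ-of i j ≡ minus
σ-of-minus {i = i} {j} ne with suc (toℕ i) % 2 ≟ suc (toℕ j) % 2
... | yes e = contradiction (%2-suc-injective {toℕ i} {toℕ j} e) ne
... | no _  = refl

σ-of≡plus⇒ : ∀ {n} {i j : Fin n} → σ-of i j ≡ plus → toℕ i % 2 ≡ toℕ j % 2
σ-of≡plus⇒ {i = i} {j} s with toℕ i % 2 ≟ toℕ j % 2
... | yes e = e
... | no ne = contradiction (trans (sym s) (σ-of-minus ne)) λ ()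

σ-of≡minus⇒ : ∀ {n} {i j : Fin n} → σ-of i j ≡ minus → toℕ i % 2 ≢ toℕ j % 2
σ-of≡minus⇒ s e = contradiction (trans (sym s) (σ-of-plus e)) λ ()

toℕ/2<⌈n/2⌉ : ∀ {n} (i : Fin n) → toℕ i / 2 < ⌈ n /2⌉
toℕ/2<⌈n/2⌉ {n} i = m<n*o⇒m/o<n (≤-trans (toℕ<n i) (n≤⌈n/2⌉*2 n))

-- Halving the index is injective on indices of equal parity.
equal-parity⇒≤⌈n/2⌉ : ∀ {k n} (h : Fin k → Fin n) → Injective _≡_ _≡_ h →
                      (∀ x y → toℕ (h x) % 2 ≡ toℕ (h y) % 2) → k ≤ ⌈ n /2⌉
equal-parity⇒≤⌈n/2⌉ {k} {n} h h-injective equal-parity = injective⇒≤ halve-injective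
  where
  halve : Fin k → Fin ⌈ n /2⌉
  halve x = fromℕ< (toℕ/2<⌈n/2⌉ (h x))

  halve-injective : Injective _≡_ _≡_ halve
  halve-injective {x} {y} e = h-injective (toℕ-injective (%2-/2-injective (equal-parity x y) (begin
    toℕ (h x) / 2     ≡⟨ toℕ-fromℕ< (toℕ/2<⌈n/2⌉ (h x)) ⟨
    toℕ (halve x)     ≡⟨ cong toℕ e ⟩
    toℕ (halve y)     ≡⟨ toℕ-fromℕ< (toℕ/2<⌈n/2⌉ (h y)) ⟩
    toℕ (h y) / 2     ∎)))

merge : ∀ n → Fin ⌈ n /2⌉ ⊎ Fin ⌊ n /2⌋ → Fin n
merge (suc n) (inj₁ zero)    = zero
merge (suc n) (inj₁ (suc j)) = suc (merge n (inj₂ j))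
merge (suc n) (inj₂ j)       = suc (merge n (inj₁ j))

split : ∀ n → Fin n → Fin ⌈ n /2⌉ ⊎ Fin ⌊ n /2⌋
split (suc n) zero    = inj₁ zero
split (suc n) (suc i) = map₁ suc (swap (split n i))

merge-split : ∀ n i → merge n (split n i) ≡ i
merge-split (suc n) zero = refl
merge-split (suc n) (suc i) with split n i | merge-split n i
... | inj₁ _ | e = cong suc e
... | inj₂ _ | e = cong suc e

split-merge : ∀ n x → split n (merge n x) ≡ x
split-merge (suc n) (inj₁ zero)    = refl
split-merge (suc n) (inj₁ (suc j)) = cong (map₁ suc ∘ swap) (split-merge n (inj₂ j))
split-merge (suc n) (inj₂ j)       = cong (map₁ suc ∘ swap) (split-merge n (inj₁ j))

interleave : ∀ n → (Fin ⌈ n /2⌉ ⊎ Fin ⌊ n /2⌋) ↔ Fin n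
interleave n = mk↔ₛ′ (merge n) (split n) (merge-split n) (split-merge n)

toℕ-merge-inj₁ : ∀ n j → toℕ (merge n (inj₁ j)) ≡ toℕ j * 2
toℕ-merge-inj₂ : ∀ n j → toℕ (merge n (inj₂ j)) ≡ suc (toℕ j * 2)
toℕ-merge-inj₁ (suc n) zero    = refl
toℕ-merge-inj₁ (suc n) (suc j) = cong suc (toℕ-merge-inj₂ n j)
toℕ-merge-inj₂ (suc n) j       = cong suc (toℕ-merge-inj₁ n j)

sideSign : ∀ {A B : Set} → A ⊎ B → A ⊎ B → Sign
sideSign (inj₁ _) (inj₁ _) = plus
sideSign (inj₂ _) (inj₂ _) = plus
sideSign (inj₁ _) (inj₂ _) = minus
sideSign (inj₂ _) (inj₁ _) = minus

sideSign-swap : ∀ {A B : Set} (x y : A ⊎ B) → sideSign (swap x) (swap y) ≡ sideSign x y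
sideSign-swap (inj₁ _) (inj₁ _) = refl
sideSign-swap (inj₂ _) (inj₂ _) = refl
sideSign-swap (inj₁ _) (inj₂ _) = refl
sideSign-swap (inj₂ _) (inj₁ _) = refl

SignsBySide : ∀ {A B : Set} {n} → (A ⊎ B → Fin n) → Set
SignsBySide g = ∀ x y → σ-of (g x) (g y) ≡ sideSign x y

sideParity : ∀ {A B : Set} → A ⊎ B → ℕ
sideParity (inj₁ _) = 0
sideParity (inj₂ _) = 1

parity-by-side⇒signs-by-side : ∀ {A B : Set} {n} (g : A ⊎ B → Fin n) →
                               (∀ x → toℕ (g x) % 2 ≡ sideParity x) → SignsBySide g
parity-by-side⇒signs-by-side g parity x y with x | y | parity x | parity y
... | inj₁ _ | inj₁ _ | p | q = σ-of-plus (trans p (sym q))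
... | inj₂ _ | inj₂ _ | p | q = σ-of-plus (trans p (sym q))
... | inj₁ _ | inj₂ _ | p | q = σ-of-minus (λ e → contradiction (trans (sym p) (trans e q)) λ ())
... | inj₂ _ | inj₁ _ | p | q = σ-of-minus (λ e → contradiction (trans (sym p) (trans e q)) λ ())

merge-parity : ∀ n x → toℕ (merge n x) % 2 ≡ sideParity x
merge-parity n (inj₁ j) = trans (cong (_% 2) (toℕ-merge-inj₁ n j)) (m*n%n≡0 (toℕ j) 2)
merge-parity n (inj₂ j) = trans (cong (_% 2) (toℕ-merge-inj₂ n j)) ([m+kn]%n≡m%n 1 (toℕ j) 2)

ParityLabelling : ℕ → ℕ → ℕ → Set
ParityLabelling k l n = Σ ((Fin k ⊎ Fin l) ↔ Fin n) λ g → SignsBySide (Inverse.to g)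

interleaving : ∀ n → ParityLabelling ⌈ n /2⌉ ⌊ n /2⌋ n
interleaving n = interleave n , parity-by-side⇒signs-by-side (merge n) (merge-parity n)

swap-labelling : ∀ {k l n} → ParityLabelling k l n → ParityLabelling l k n
swap-labelling (g , signs) = ↔-trans (⊎-comm _ _) g , λ x y → trans (signs (swap x) (swap y)) (sideSign-swap x y)

cast-labelling : ∀ {k l n k′ l′ n′} → k ≡ k′ → l ≡ l′ → n ≡ n′ → ParityLabelling k l n → ParityLabelling k′ l′ n′
cast-labelling refl refl refl = id

odd-labelling : ∀ k → ParityLabelling (suc k) k (suc (k + k))
odd-labelling k = cast-labelling (cong suc (sym (n≡⌊n+n/2⌋ k))) (sym (n≡⌈n+n/2⌉ k)) refl (interleaving (suc (k + k)))

even-labelling : ∀ k → ParityLabelling k k (k + k)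
even-labelling k = cast-labelling (sym (n≡⌈n+n/2⌉ k)) (sym (n≡⌊n+n/2⌋ k)) refl (interleaving (k + k))

BVtx↔sides : ∀ {m n} → BVtx m n ↔ (Fin (2 + m) ⊎ Fin n)
BVtx↔sides {m} {n} = mk↔ₛ′ to from to-from from-to
  where
  to : BVtx m n → Fin (2 + m) ⊎ Fin n
  to u     = inj₁ zero
  to v     = inj₁ (suc zero)
  to (a i) = inj₁ (suc (suc i))
  to (b j) = inj₂ j

  from : Fin (2 + m) ⊎ Fin n → BVtx m n
  from (inj₁ zero)          = u
  from (inj₁ (suc zero))    = v
  from (inj₁ (suc (suc i))) = a i
  from (inj₂ j)             = b j

  to-from : ∀ x → to (from x) ≡ x
  to-from (inj₁ zero)          = refl
  to-from (inj₁ (suc zero))    = refl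
  to-from (inj₁ (suc (suc i))) = refl
  to-from (inj₂ j)             = refl

  from-to : ∀ x → from (to x) ≡ x
  from-to u     = refl
  from-to v     = refl
  from-to (a i) = refl
  from-to (b j) = refl

labelling⇒bistar-parity-signed : ∀ {m n} → ParityLabelling (2 + m) n (m + n + 2) → IsParitySigned (Bistar⁺ m n)
labelling⇒bistar-parity-signed (g , signs) = ↔-trans BVtx↔sides g , λ where
  uv     → sym (signs _ _)
  (ua i) → sym (signs _ _)
  (vb j) → sym (signs _ _)

bistar-parity-signed⇒sides≤⌈n/2⌉ : ∀ {m n} → IsParitySigned (Bistar⁺ m n) →
                                  2 + m ≤ ⌈ m + n + 2 /2⌉ × n ≤ ⌈ m + n + 2 /2⌉
bistar-parity-signed⇒sides≤⌈n/2⌉ {m} {n} (f , sign) =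
    equal-parity⇒≤⌈n/2⌉ (label ∘ inj₁) (inj₁-injective ∘ label-injective) u-class-equal-parity
  , equal-parity⇒≤⌈n/2⌉ (label ∘ inj₂) (inj₂-injective ∘ label-injective) v-pendants-equal-parity
  where
  labelling : (Fin (2 + m) ⊎ Fin n) ↔ Fin (m + n + 2)
  labelling = ↔-trans (↔-sym BVtx↔sides) f

  label : Fin (2 + m) ⊎ Fin n → Fin (m + n + 2)
  label = Inverse.to labelling

  label-injective : Injective _≡_ _≡_ label
  label-injective = Injection.injective (↔⇒↣ labelling)

  index : Fin (2 + m) ⊎ Fin n → ℕ
  index = toℕ ∘ label

  like-u : ∀ x → index (inj₁ x) % 2 ≡ index (inj₁ zero) % 2
  like-u zero          = refl
  like-u (suc zero)    = sym (σ-of≡plus⇒ (sym (sign uv)))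
  like-u (suc (suc i)) = sym (σ-of≡plus⇒ (sym (sign (ua i))))

  unlike-v : ∀ j → index (inj₂ j) % 2 ≢ index (inj₁ (suc zero)) % 2
  unlike-v j = σ-of≡minus⇒ (sym (sign (vb j))) ∘ sym

  u-class-equal-parity : ∀ x y → index (inj₁ x) % 2 ≡ index (inj₁ y) % 2
  u-class-equal-parity x y = trans (like-u x) (sym (like-u y))

  v-pendants-equal-parity : ∀ x y → index (inj₂ x) % 2 ≡ index (inj₂ y) % 2
  v-pendants-equal-parity x y = %2-≢⇒≡ (index (inj₂ x)) (index (inj₂ y)) (index (inj₁ (suc zero))) (unlike-v x) (unlike-v y)

≤⌈n/2⌉⇒*2≤1+n : ∀ {k n} → k ≤ ⌈ n /2⌉ → k * 2 ≤ suc n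
≤⌈n/2⌉⇒*2≤1+n {n = n} k≤ = ≤-trans (*-monoˡ-≤ 2 k≤) (⌈n/2⌉*2≤1+n n)

sides≤⌈n/2⌉⇒window : ∀ m n → 2 + m ≤ ⌈ m + n + 2 /2⌉ × n ≤ ⌈ m + n + 2 /2⌉ → suc m ≤ n × n ≤ m + 3
sides≤⌈n/2⌉⇒window m n (u-class , v-pendants) =
    +-cancelˡ-≤ (m + 3) (suc m) n (subst₂ _≤_ (u-class-twice m) (vertices+1 m n) (≤⌈n/2⌉⇒*2≤1+n u-class))
  , +-cancelˡ-≤ n n (m + 3) (subst₂ _≤_ (v-pendants-twice n) (vertices+1′ m n) (≤⌈n/2⌉⇒*2≤1+n v-pendants))
  where
  u-class-twice : ∀ m → (2 + m) * 2 ≡ (m + 3) + suc m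
  u-class-twice = solve-∀
  v-pendants-twice : ∀ n → n * 2 ≡ n + n
  v-pendants-twice = solve-∀
  vertices+1 : ∀ m n → suc (m + n + 2) ≡ (m + 3) + n
  vertices+1 = solve-∀
  vertices+1′ : ∀ m n → suc (m + n + 2) ≡ n + (m + 3)
  vertices+1′ = solve-∀

window⇒cases : ∀ {m n} → suc m ≤ n × n ≤ m + 3 → n ≡ m + 1 ⊎ n ≡ m + 2 ⊎ n ≡ m + 3
window⇒cases {zero} {1} _ = inj₁ refl
window⇒cases {zero} {2} _ = inj₂ (inj₁ refl)
window⇒cases {zero} {3} _ = inj₂ (inj₂ refl)
window⇒cases {zero} {suc (suc (suc (suc _)))} (_ , s≤s (s≤s (s≤s ())))
window⇒cases {suc m} {suc n} (s≤s lo , s≤s hi) = map (cong suc) (map (cong suc) (cong suc)) (window⇒cases (lo , hi))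

[m+[m+r]]%2≡r%2 : ∀ m r → (m + (m + r)) % 2 ≡ r % 2
[m+[m+r]]%2≡r%2 m r = trans (cong (_% 2) (rearrange m r)) ([m+kn]%n≡m%n r m 2)
  where
  rearrange : ∀ m r → m + (m + r) ≡ r + m * 2
  rearrange = solve-∀

bistar-m+1 : ∀ m → IsParitySigned (Bistar⁺ m (m + 1))
bistar-m+1 m = labelling⇒bistar-parity-signed (cast-labelling refl (+-comm 1 m) (size m) (odd-labelling (suc m)))
  where
  size : ∀ m → suc (suc m + suc m) ≡ m + (m + 1) + 2
  size = solve-∀

bistar-m+2 : ∀ m → IsParitySigned (Bistar⁺ m (m + 2))
bistar-m+2 m = labelling⇒bistar-parity-signed (cast-labelling refl (+-comm 2 m) (size m) (even-labelling (2 + m)))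
  where
  size : ∀ m → (2 + m) + (2 + m) ≡ m + (m + 2) + 2
  size = solve-∀

bistar-m+3 : ∀ m → IsParitySigned (Bistar⁺ m (m + 3))
bistar-m+3 m = labelling⇒bistar-parity-signed (cast-labelling refl (+-comm 3 m) (size m) (swap-labelling (odd-labelling (2 + m))))
  where
  size : ∀ m → suc ((2 + m) + (2 + m)) ≡ m + (m + 3) + 2
  size = solve-∀

theorem9 : (m n : ℕ) →
    IsParitySigned (Bistar⁺ m n) ⇔
      (((m + n) % 2 ≡ 1 × (n ≡ m + 1 ⊎ n ≡ m + 3)) ⊎ ((m + n) % 2 ≡ 0 × n ≡ m + 2))
theorem9 m n = mk⇔ necessary sufficient
  where
  necessary : IsParitySigned (Bistar⁺ m n) →
              ((m + n) % 2 ≡ 1 × (n ≡ m + 1 ⊎ n ≡ m + 3)) ⊎ ((m + n) % 2 ≡ 0 × n ≡ m + 2)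
  necessary signed with window⇒cases (sides≤⌈n/2⌉⇒window m n (bistar-parity-signed⇒sides≤⌈n/2⌉ signed))
  ... | inj₁ refl        = inj₁ ([m+[m+r]]%2≡r%2 m 1 , inj₁ refl)
  ... | inj₂ (inj₁ refl) = inj₂ ([m+[m+r]]%2≡r%2 m 2 , refl)
  ... | inj₂ (inj₂ refl) = inj₁ ([m+[m+r]]%2≡r%2 m 3 , inj₂ refl)

  sufficient : ((m + n) % 2 ≡ 1 × (n ≡ m + 1 ⊎ n ≡ m + 3)) ⊎ ((m + n) % 2 ≡ 0 × n ≡ m + 2) →
               IsParitySigned (Bistar⁺ m n)
  sufficient (inj₁ (_ , inj₁ refl)) = bistar-m+1 m
  sufficient (inj₁ (_ , inj₂ refl)) = bistar-m+3 m
  sufficient (inj₂ (_ , refl))      = bistar-m+2 m
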